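{- The halting problem is not weakly intrinsically generic-case computable; that is, there is a computable permutation $\pi:\omega\to\omega$ such that $\pi(\emptyset')$ is not generic-case computable.
   Context: For $X\subseteq\omega$, $\rho_n(X)=|X\cap[0,n)|/n$ and $X$ has density $1$ if $\lim_n\rho_n(X)=1$. A partial function $f:\omega\to\{0,1\}$ is a partial description of $A$ if $f(n)=A(n)$ whenever $f(n)$ converges. $A$ is generic-case computable if it has a partial computable partial description whose domain has density $1$. $A$ is (weakly) intrinsically generic-case computable if $\pi(A)$ is generic-case computable for every computable permutation $\pi$ of $\omega$. -}

module Defs where

open import Data.Nat using (ℕ; zero; suc; _+_; _*_; _≤_; _<_)
open import Data.Product using (Σ; ∃; ∃-syntax; _×_; _,_; proj₁; proj₂)
open import Data.Sum using (_⊎_)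
open import Data.List using (List; length)
open import Data.List.Relation.Unary.All using (All)
open import Data.List.Relation.Unary.Unique.Propositional using (Unique)
open import Relation.Binary.PropositionalEquality using (_≡_)
open import Relation.Nullary using (¬_)
open import Function.Definitions using (Bijective)

tri : ℕ → ℕ
tri zero    = zero
tri (suc k) = suc k + tri k

pair : ℕ → ℕ → ℕ
pair x y = tri (x + y) + x

nextPair : ℕ × ℕ → ℕ × ℕ
nextPair (x , zero)  = (zero , suc x)
nextPair (x , suc y) = (suc x , y)

unpair : ℕ → ℕ × ℕ
unpair zero    = (zero , zero)
unpair (suc n) = nextPair (unpair n)

-- A model of (unary) partial recursive functions on ℕ.

data Code : Set where
  cZero  : Code
  cSucc  : Code
  cId    : Code
  cFst   : Code
  cSnd   : Code
  cComp  : Code → Code → Code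
  cPair  : Code → Code → Code
  cRec   : Code → Code → Code
  cMu    : Code → Code

data Eval : Code → ℕ → ℕ → Set where
  eZero : ∀ {x} → Eval cZero x 0
  eSucc : ∀ {x} → Eval cSucc x (suc x)
  eId   : ∀ {x} → Eval cId x x
  eFst  : ∀ {x} → Eval cFst x (proj₁ (unpair x))
  eSnd  : ∀ {x} → Eval cSnd x (proj₂ (unpair x))
  eComp : ∀ {f g x y z} → Eval g x y → Eval f y z → Eval (cComp f g) x z
  ePair : ∀ {f g x y z} → Eval f x y → Eval g x z → Eval (cPair f g) x (pair y z)
  eRec0 : ∀ {f g x a y} → unpair x ≡ (a , zero) → Eval f a y → Eval (cRec f g) x y
  eRecS : ∀ {f g x a n r y} → unpair x ≡ (a , suc n) →
          Eval (cRec f g) (pair a n) r → Eval g (pair a (pair n r)) y →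
          Eval (cRec f g) x y
  eMu   : ∀ {f x n} → Eval f (pair x n) zero →
          (∀ m → m < n → ∃[ v ] Eval f (pair x m) (suc v)) →
          Eval (cMu f) x n

Halts : Code → ℕ → Set
Halts c x = ∃[ y ] Eval c x y

encode : Code → ℕ
encode cZero       = pair 0 0
encode cSucc       = pair 1 0
encode cId         = pair 2 0
encode cFst        = pair 3 0
encode cSnd        = pair 4 0
encode (cComp f g) = pair 5 (pair (encode f) (encode g))
encode (cPair f g) = pair 6 (pair (encode f) (encode g))
encode (cRec f g)  = pair 7 (pair (encode f) (encode g))
encode (cMu f)     = pair 8 (encode f)

-- φ_e is the function coded by e (nowhere defined if e is not a code).
-- The halting problem ∅' = { e : φ_e(e)↓ }.
HaltingSet : ℕ → Set
HaltingSet e = Σ Code λ c → encode c ≡ e × Halts c e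

Computable : (ℕ → ℕ) → Set
Computable f = ∃[ c ] (∀ n → Eval c n (f n))

ComputablePermutation : (ℕ → ℕ) → Set
ComputablePermutation π = Computable π × Bijective _≡_ _≡_ π

image : (ℕ → ℕ) → (ℕ → Set) → ℕ → Set
image π A m = ∃[ n ] (π n ≡ m × A n)

-- lim_n ρ_n(X) = 1, i.e. for every k, eventually ρ_n(X) ≥ k/(k+1)
-- (equivalently |X ∩ [0,n)| * (k+1) ≥ k * n).
HasDensityOne : (ℕ → Set) → Set
HasDensityOne X =
  ∀ k → ∃[ N ] (∀ n → N ≤ n →
    Σ (List ℕ) λ l → Unique l × All (λ i → i < n × X i) l ×
      k * n ≤ suc k * length l)

PartialDescription : Code → (ℕ → Set) → Set
PartialDescription c A =
  (∀ n v → Eval c n v → v ≡ 0 ⊎ v ≡ 1) ×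
  (∀ n → Eval c n 1 → A n) ×
  (∀ n → Eval c n 0 → ¬ A n)

GenericCaseComputable : (ℕ → Set) → Set
GenericCaseComputable A =
  ∃[ c ] (PartialDescription c A × HasDensityOne (Halts c))

-- We construct a primitive recursive involution π with π(∅') not generic-case
-- computable.  ℕ is cut into dyadic blocks [2ᵗ , 2ᵗ⁺¹); the block index names a code
-- diagCode x = encode (cComp f g), and every code cComp c πOfFst (πOfFst : ⟨e , m⟩ ↦ π e)
-- is named by arbitrarily late blocks.  π swaps each x whose first Cantor component is
-- not 8 with the Gödel number of the refuter cMu (pad x (cComp c πOfFst)), which halts on
-- input e iff c(π e) = 0; the x padding layers make the swap decodable (by peeling), so
-- π is a computable involution.  Hence x ∈ π(∅') iff c(x) = 0, and a {0,1}-valued partial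
-- description c cannot converge at such x.  In a late block [2q , 4q) owned by c, c
-- therefore converges at most on [0 , 2q) and on the q tagged numbers ⟨8 , b⟩ < 4q,
-- i.e. on at most 3/4 of [0 , 4q), contradicting density 1.

module Submission where

open import Defs
open import Data.Nat
open import Data.Nat.Properties
open import Data.Nat.GeneralisedArithmetic using (fold)
open import Data.Nat.Tactic.RingSolver using (solve-∀)
open import Data.Empty using (⊥; ⊥-elim)
open import Data.Maybe using (Maybe; just; nothing; zipWith)
import Data.Maybe as Maybe
open import Data.Maybe.Properties using (just-injective)
open import Data.Product using (Σ; ∃-syntax; _×_; _,_; proj₁; proj₂; uncurry)
open import Data.Sum using (_⊎_; inj₁; inj₂)
open import Data.List using ([]; _∷_; length; map)
open import Data.List.Properties using (length-map)
open import Data.List.Relation.Unary.All as All using (All; []; _∷_)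
open import Data.List.Relation.Unary.All.Properties using (gmap⁺)
open import Data.List.Relation.Unary.AllPairs using ([]; _∷_)
open import Data.List.Relation.Unary.Unique.Propositional using (Unique)
open import Function.Bundles using (_⇔_; mk⇔; Equivalence)
open import Function.Definitions using (Bijective)
open import Relation.Binary.Definitions using (tri<; tri≈; tri>)
open import Relation.Binary.PropositionalEquality
open import Relation.Nullary using (¬_; Dec; yes; no; contradiction)

unpair₁ unpair₂ : ℕ → ℕ
unpair₁ x = proj₁ (unpair x)
unpair₂ x = proj₂ (unpair x)

pair-nextPair : ∀ p → uncurry pair (nextPair p) ≡ suc (uncurry pair p)
pair-nextPair (a , zero)
  rewrite +-identityʳ a | +-identityʳ (a + tri a) | +-comm a (tri a) = refl
pair-nextPair (a , suc b)
  rewrite +-suc a b | +-suc (tri (suc (a + b))) a = refl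

unpair-pair : ∀ a b → unpair (pair a b) ≡ (a , b)
unpair-pair a b = go a b (pair a b) refl
  where
  go : ∀ a b n → pair a b ≡ n → unpair n ≡ (a , b)
  go zero    zero    zero    _  = refl
  go zero    (suc b) (suc n) eq =
    cong nextPair (go b zero n (suc-injective (trans (sym (pair-nextPair (b , zero))) eq)))
  go (suc a) b       (suc n) eq =
    cong nextPair (go a (suc b) n (suc-injective (trans (sym (pair-nextPair (a , suc b))) eq)))

unpair₁-pair : ∀ a b → unpair₁ (pair a b) ≡ a
unpair₁-pair a b = cong proj₁ (unpair-pair a b)

unpair₂-pair : ∀ a b → unpair₂ (pair a b) ≡ b
unpair₂-pair a b = cong proj₂ (unpair-pair a b)

pair-unpair : ∀ x → pair (unpair₁ x) (unpair₂ x) ≡ x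
pair-unpair zero    = refl
pair-unpair (suc x) = trans (pair-nextPair (unpair x)) (cong suc (pair-unpair x))

n≤tri : ∀ n → n ≤ tri n
n≤tri zero    = z≤n
n≤tri (suc n) = s≤s (m≤m+n n (tri n))

≤-pair₁ : ∀ a b → a ≤ pair a b
≤-pair₁ a b = m≤n+m a (tri (a + b))

≤-pair₂ : ∀ a b → b ≤ pair a b
≤-pair₂ a b = ≤-trans (m≤n+m b a) (≤-trans (n≤tri (a + b)) (m≤m+n (tri (a + b)) a))

data PR : Set where
  pZero pSucc pId pFst pSnd : PR
  pComp pPair pRec : PR → PR → PR

compile : PR → Code
compile pZero       = cZero
compile pSucc       = cSucc
compile pId         = cId
compile pFst        = cFst
compile pSnd        = cSnd
compile (pComp f g) = cComp (compile f) (compile g)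
compile (pPair f g) = cPair (compile f) (compile g)
compile (pRec f g)  = cRec (compile f) (compile g)

primRec : (ℕ → ℕ) → (ℕ → ℕ) → ℕ → ℕ → ℕ
primRec f g a zero    = f a
primRec f g a (suc n) = g (pair a (pair n (primRec f g a n)))

⟦_⟧ : PR → ℕ → ℕ
⟦ pZero ⟧     x = 0
⟦ pSucc ⟧     x = suc x
⟦ pId ⟧       x = x
⟦ pFst ⟧      x = unpair₁ x
⟦ pSnd ⟧      x = unpair₂ x
⟦ pComp f g ⟧ x = ⟦ f ⟧ (⟦ g ⟧ x)
⟦ pPair f g ⟧ x = pair (⟦ f ⟧ x) (⟦ g ⟧ x)
⟦ pRec f g ⟧  x = primRec ⟦ f ⟧ ⟦ g ⟧ (unpair₁ x) (unpair₂ x)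

mutual
  compile-sound : ∀ p x → Eval (compile p) x (⟦ p ⟧ x)
  compile-sound pZero       x = eZero
  compile-sound pSucc       x = eSucc
  compile-sound pId         x = eId
  compile-sound pFst        x = eFst
  compile-sound pSnd        x = eSnd
  compile-sound (pComp f g) x = eComp (compile-sound g x) (compile-sound f (⟦ g ⟧ x))
  compile-sound (pPair f g) x = ePair (compile-sound f x) (compile-sound g x)
  compile-sound (pRec f g)  x = primRec-sound f g (unpair₂ x) x refl

  primRec-sound : ∀ f g n x → unpair x ≡ (unpair₁ x , n) →
    Eval (cRec (compile f) (compile g)) x (primRec ⟦ f ⟧ ⟦ g ⟧ (unpair₁ x) n)
  primRec-sound f g zero    x eq = eRec0 eq (compile-sound f (unpair₁ x))
  primRec-sound f g (suc n) x eq = eRecS eq previous (compile-sound g _)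
    where
    a = unpair₁ x
    previous : Eval (cRec (compile f) (compile g)) (pair a n) (primRec ⟦ f ⟧ ⟦ g ⟧ a n)
    previous = subst (λ b → Eval (cRec (compile f) (compile g)) (pair a n) (primRec ⟦ f ⟧ ⟦ g ⟧ b n))
                     (unpair₁-pair a n)
                     (primRec-sound f g n (pair a n)
                       (trans (unpair-pair a n) (cong (_, n) (sym (unpair₁-pair a n)))))

pRec-pair : ∀ f g a n → ⟦ pRec f g ⟧ (pair a n) ≡ primRec ⟦ f ⟧ ⟦ g ⟧ a n
pRec-pair f g a n rewrite unpair₁-pair a n | unpair₂-pair a n = refl

pConst : ℕ → PR
pConst zero    = pZero
pConst (suc n) = pComp pSucc (pConst n)

ifZero : ℕ → ℕ → ℕ → ℕ
ifZero zero    t e = t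
ifZero (suc _) t e = e

-- Case distinction on c = 0, by a recursion of length c on ⟨x , c⟩.
pIfZero : PR → PR → PR → PR
pIfZero c t e = pComp (pRec t (pComp e pFst)) (pPair pId c)

pIfZero-sem : ∀ c t e x → ⟦ pIfZero c t e ⟧ x ≡ ifZero (⟦ c ⟧ x) (⟦ t ⟧ x) (⟦ e ⟧ x)
pIfZero-sem c t e x rewrite pRec-pair t (pComp e pFst) x (⟦ c ⟧ x) with ⟦ c ⟧ x
... | zero  = refl
... | suc n = cong ⟦ e ⟧ (unpair₁-pair x _)

fold-cong : ∀ {f g : ℕ → ℕ} → (∀ x → f x ≡ g x) → ∀ x n → fold x f n ≡ fold x g n
fold-cong         f≗g x zero    = refl
fold-cong {g = g} f≗g x (suc n) = trans (f≗g _) (cong g (fold-cong f≗g x n))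

fold-suc : ∀ {A : Set} (x : A) f n → fold x f (suc n) ≡ fold (f x) f n
fold-suc x f zero    = refl
fold-suc x f (suc n) = cong f (fold-suc x f n)

pFold : PR → PR → PR
pFold i s = pRec i (pComp s (pComp pSnd pSnd))

pFold-sem : ∀ i s a n → ⟦ pFold i s ⟧ (pair a n) ≡ fold (⟦ i ⟧ a) ⟦ s ⟧ n
pFold-sem i s a n = trans (pRec-pair i step a n) (go n)
  where
  step = pComp s (pComp pSnd pSnd)
  go : ∀ n → primRec ⟦ i ⟧ ⟦ step ⟧ a n ≡ fold (⟦ i ⟧ a) ⟦ s ⟧ n
  go zero    = refl
  go (suc n) rewrite unpair₂-pair a (pair n (primRec ⟦ i ⟧ ⟦ step ⟧ a n))
                   | unpair₂-pair n (primRec ⟦ i ⟧ ⟦ step ⟧ a n) = cong ⟦ s ⟧ (go n)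

pPred : PR
pPred = pComp (pRec pZero (pComp pFst pSnd)) (pPair pZero pId)

pPred-sem : ∀ x → ⟦ pPred ⟧ x ≡ pred x
pPred-sem x rewrite pRec-pair pZero (pComp pFst pSnd) 0 x with x
... | zero  = refl
... | suc n rewrite unpair₂-pair 0 (pair n (primRec ⟦ pZero ⟧ ⟦ pComp pFst pSnd ⟧ 0 n)) =
  unpair₁-pair n _

pMonus : PR
pMonus = pFold pId pPred

pMonus-sem : ∀ a b → ⟦ pMonus ⟧ (pair a b) ≡ a ∸ b
pMonus-sem a b = trans (pFold-sem pId pPred a b) (trans (fold-cong pPred-sem a b) (go b))
  where
  go : ∀ b → fold a pred b ≡ a ∸ b
  go zero    = refl
  go (suc b) = trans (cong pred (go b)) (pred[m∸n]≡m∸[1+n] a b)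

pAdd : PR
pAdd = pFold pId pSucc

pAdd-sem : ∀ a b → ⟦ pAdd ⟧ (pair a b) ≡ a + b
pAdd-sem a b = trans (pFold-sem pId pSucc a b) (go b)
  where
  go : ∀ b → fold a suc b ≡ a + b
  go zero    = sym (+-identityʳ a)
  go (suc b) = trans (cong suc (go b)) (sym (+-suc a b))

opaque
  ifEq : ℕ → ℕ → ℕ → ℕ → ℕ
  ifEq a b t e = ifZero (a ∸ b) (ifZero (b ∸ a) t e) e

  ifEq-≡ : ∀ {a b} t e → a ≡ b → ifEq a b t e ≡ t
  ifEq-≡ {a} t e refl rewrite n∸n≡0 a = refl

  ifEq-≢ : ∀ {a b} t e → a ≢ b → ifEq a b t e ≡ e
  ifEq-≢ {a} {b} t e a≢b with a ∸ b in p | b ∸ a in q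
  ... | suc _ | _     = refl
  ... | zero  | suc _ = refl
  ... | zero  | zero  = ⊥-elim (a≢b (≤-antisym (m∸n≡0⇒m≤n p) (m∸n≡0⇒m≤n q)))

  pIfEq : PR → PR → PR → PR → PR
  pIfEq f g t e = pIfZero (pComp pMonus (pPair f g)) (pIfZero (pComp pMonus (pPair g f)) t e) e

  pIfEq-sem : ∀ f g t e x → ⟦ pIfEq f g t e ⟧ x ≡ ifEq (⟦ f ⟧ x) (⟦ g ⟧ x) (⟦ t ⟧ x) (⟦ e ⟧ x)
  pIfEq-sem f g t e x
    rewrite pIfZero-sem (pComp pMonus (pPair f g)) (pIfZero (pComp pMonus (pPair g f)) t e) e x
          | pIfZero-sem (pComp pMonus (pPair g f)) t e x
          | pMonus-sem (⟦ f ⟧ x) (⟦ g ⟧ x) | pMonus-sem (⟦ g ⟧ x) (⟦ f ⟧ x) = refl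

Eval-deterministic : ∀ {c x y y′} → Eval c x y → Eval c x y′ → y ≡ y′
Eval-deterministic eZero eZero = refl
Eval-deterministic eSucc eSucc = refl
Eval-deterministic eId   eId   = refl
Eval-deterministic eFst  eFst  = refl
Eval-deterministic eSnd  eSnd  = refl
Eval-deterministic (eComp g f) (eComp g′ f′) with Eval-deterministic g g′
... | refl = Eval-deterministic f f′
Eval-deterministic (ePair f g) (ePair f′ g′) =
  cong₂ pair (Eval-deterministic f f′) (Eval-deterministic g g′)
Eval-deterministic (eRec0 e f) (eRec0 e′ f′) with trans (sym e) e′
... | refl = Eval-deterministic f f′
Eval-deterministic (eRec0 e _) (eRecS e′ _ _) with trans (sym e) e′
... | ()
Eval-deterministic (eRecS e _ _) (eRec0 e′ _) with trans (sym e) e′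
... | ()
Eval-deterministic (eRecS e r g) (eRecS e′ r′ g′) with trans (sym e) e′
... | refl with Eval-deterministic r r′
... | refl = Eval-deterministic g g′
-- The least zero is unique: a smaller zero of one run contradicts the other.
Eval-deterministic (eMu {n = n} z below) (eMu {n = n′} z′ below′) with <-cmp n n′
... | tri≈ _ n≡n′ _ = n≡n′
... | tri< n<n′ _ _ = let (_ , pos) = below′ n n<n′ in
  contradiction (Eval-deterministic z pos) (λ ())
... | tri> _ _ n′<n = let (_ , pos) = below n′ n′<n in
  contradiction (Eval-deterministic z′ pos) (λ ())

-- Decoding Gödel numbers: decode fuel recovers every code of depth below fuel,
-- which makes encode injective.
depth : Code → ℕ
depth (cComp f g) = suc (depth f ⊔ depth g)
depth (cPair f g) = suc (depth f ⊔ depth g)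
depth (cRec f g)  = suc (depth f ⊔ depth g)
depth (cMu f)     = suc (depth f)
depth _           = zero

decodeNode : (ℕ → Maybe Code) → ℕ → ℕ → Maybe Code
decodeNode dec 0 _ = just cZero
decodeNode dec 1 _ = just cSucc
decodeNode dec 2 _ = just cId
decodeNode dec 3 _ = just cFst
decodeNode dec 4 _ = just cSnd
decodeNode dec 5 b = zipWith cComp (dec (unpair₁ b)) (dec (unpair₂ b))
decodeNode dec 6 b = zipWith cPair (dec (unpair₁ b)) (dec (unpair₂ b))
decodeNode dec 7 b = zipWith cRec  (dec (unpair₁ b)) (dec (unpair₂ b))
decodeNode dec 8 b = Maybe.map cMu (dec b)
decodeNode dec _ _ = nothing

decode : ℕ → ℕ → Maybe Code
decode zero       x = nothing
decode (suc fuel) x = decodeNode (decode fuel) (unpair₁ x) (unpair₂ x)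

decode-pair : ∀ fuel t b → decode (suc fuel) (pair t b) ≡ decodeNode (decode fuel) t b
decode-pair fuel t b rewrite unpair₁-pair t b | unpair₂-pair t b = refl

mutual
  decode-encode : ∀ c fuel → depth c < fuel → decode fuel (encode c) ≡ just c
  decode-encode cZero       (suc fuel) _  = decode-pair fuel 0 0
  decode-encode cSucc       (suc fuel) _  = decode-pair fuel 1 0
  decode-encode cId         (suc fuel) _  = decode-pair fuel 2 0
  decode-encode cFst        (suc fuel) _  = decode-pair fuel 3 0
  decode-encode cSnd        (suc fuel) _  = decode-pair fuel 4 0
  decode-encode (cComp f g) (suc fuel) (s≤s d<) =
    trans (decode-pair fuel 5 (pair (encode f) (encode g))) (decode-children cComp f g fuel d<)
  decode-encode (cPair f g) (suc fuel) (s≤s d<) =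
    trans (decode-pair fuel 6 (pair (encode f) (encode g))) (decode-children cPair f g fuel d<)
  decode-encode (cRec f g)  (suc fuel) (s≤s d<) =
    trans (decode-pair fuel 7 (pair (encode f) (encode g))) (decode-children cRec f g fuel d<)
  decode-encode (cMu f)     (suc fuel) (s≤s d<) =
    trans (decode-pair fuel 8 (encode f)) (cong (Maybe.map cMu) (decode-encode f fuel d<))

  decode-children : ∀ (node : Code → Code → Code) f g fuel → depth f ⊔ depth g < fuel →
    let x = pair (encode f) (encode g) in
    zipWith node (decode fuel (unpair₁ x)) (decode fuel (unpair₂ x)) ≡ just (node f g)
  decode-children node f g fuel d<
    rewrite unpair₁-pair (encode f) (encode g) | unpair₂-pair (encode f) (encode g)
          | decode-encode f fuel (≤-<-trans (m≤m⊔n (depth f) (depth g)) d<)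
          | decode-encode g fuel (≤-<-trans (m≤n⊔m (depth f) (depth g)) d<) = refl

encode-injective : ∀ c d → encode c ≡ encode d → c ≡ d
encode-injective c d eq = just-injective (begin
  just c                 ≡⟨ decode-encode c fuel (s≤s (m≤m+n (depth c) (depth d))) ⟨
  decode fuel (encode c) ≡⟨ cong (decode fuel) eq ⟩
  decode fuel (encode d) ≡⟨ decode-encode d fuel (s≤s (m≤n+m (depth d) (depth c))) ⟩
  just d                 ∎)
  where
  open ≡-Reasoning
  fuel = suc (depth c + depth d)

-- Padding: padLayer (encode f) = encode (cComp f cId), a code for the same function.
-- pad j f wraps f in j such layers.
padLayer : ℕ → ℕ
padLayer y = pair 5 (pair y 5)

pad : ℕ → Code → Code
pad j f = fold f (λ g → cComp g cId) j

encode-pad : ∀ j f → encode (pad j f) ≡ fold (encode f) padLayer j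
encode-pad zero    f = refl
encode-pad (suc j) f = cong padLayer (encode-pad j f)

pad-Eval⁻ : ∀ j f {x v} → Eval (pad j f) x v → Eval f x v
pad-Eval⁻ zero    f ev             = ev
pad-Eval⁻ (suc j) f (eComp eId ev) = pad-Eval⁻ j f ev

pad-Eval⁺ : ∀ j f {x v} → Eval f x v → Eval (pad j f) x v
pad-Eval⁺ zero    f ev = ev
pad-Eval⁺ (suc j) f ev = eComp eId (pad-Eval⁺ j f ev)

padLayer-> : ∀ y → y < padLayer y
padLayer-> y = ≤-trans (s≤s (≤-pair₁ y 5)) (<-pair₅ (pair y 5))
  where
  <-pair₅ : ∀ w → w < pair 5 w
  <-pair₅ w = ≤-trans (m≤n+m (suc w) 4) (≤-trans (n≤tri (5 + w)) (m≤m+n _ 5))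

n≤padded : ∀ n z → n ≤ fold z padLayer n
n≤padded zero    z = z≤n
n≤padded (suc n) z = ≤-trans (s≤s (n≤padded n z)) (padLayer-> (fold z padLayer n))

-- The state ⟨w , j⟩ records the
-- remaining code w and the number j of layers removed so far; a step strips one
-- layer when w = ⟨5 , ⟨w′ , 5⟩⟩ = padLayer w′.
peelStep : ℕ → ℕ
peelStep st =
  ifEq (unpair₁ w) 5 (ifEq (unpair₂ (unpair₂ w)) 5 (pair (unpair₁ (unpair₂ w)) (suc j)) st) st
  where
  w = unpair₁ st
  j = unpair₂ st

peel : ℕ → ℕ
peel y = fold (pair y 0) peelStep y

peelStep-padLayer : ∀ w j → peelStep (pair (padLayer w) j) ≡ pair w (suc j)
peelStep-padLayer w j
  rewrite unpair₁-pair (padLayer w) j | unpair₂-pair (padLayer w) j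
        | unpair₁-pair 5 (pair w 5) | unpair₂-pair 5 (pair w 5)
        | unpair₁-pair w 5 | unpair₂-pair w 5 = trans (ifEq-≡ _ _ refl) (ifEq-≡ _ _ refl)

Stuck : ℕ → Set
Stuck z = ∀ j → peelStep (pair z j) ≡ pair z j

stuck : ∀ z → unpair₂ (unpair₂ z) ≢ 5 → Stuck z
stuck z ≢5 j rewrite unpair₁-pair z j with unpair₁ z ≟ 5
... | no  ≢5′ = ifEq-≢ _ _ ≢5′
... | yes ≡5  = trans (ifEq-≡ _ _ ≡5) (ifEq-≢ _ _ ≢5)

peel-run : ∀ z → Stuck z → ∀ m k j → m ≤ k →
  fold (pair (fold z padLayer m) j) peelStep k ≡ pair z (m + j)
peel-run z z-stuck zero k j _ = stay k
  where
  stay : ∀ k → fold (pair z j) peelStep k ≡ pair z j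
  stay zero    = refl
  stay (suc k) = trans (cong peelStep (stay k)) (z-stuck j)
peel-run z z-stuck (suc m) (suc k) j (s≤s m≤k) = begin
  fold (pair (padLayer (fold z padLayer m)) j) peelStep (suc k)
    ≡⟨ fold-suc _ peelStep k ⟩
  fold (peelStep (pair (padLayer (fold z padLayer m)) j)) peelStep k
    ≡⟨ cong (λ st → fold st peelStep k) (peelStep-padLayer (fold z padLayer m) j) ⟩
  fold (pair (fold z padLayer m) (suc j)) peelStep k
    ≡⟨ peel-run z z-stuck m k (suc j) m≤k ⟩
  pair z (m + suc j)
    ≡⟨ cong (pair z) (+-suc m j) ⟩
  pair z (suc m + j) ∎
  where open ≡-Reasoning

peel-padded : ∀ z → Stuck z → ∀ m → peel (fold z padLayer m) ≡ pair z m
peel-padded z z-stuck m =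
  trans (peel-run z z-stuck m _ 0 (n≤padded m z)) (cong (pair z) (+-identityʳ m))

-- The number a peeling state stands for; peeling never changes it.
unpeel : ℕ → ℕ
unpeel st = fold (unpair₁ st) padLayer (unpair₂ st)

unpeel-pair : ∀ w j → unpeel (pair w j) ≡ fold w padLayer j
unpeel-pair w j = cong₂ (λ w j → fold w padLayer j) (unpair₁-pair w j) (unpair₂-pair w j)

unpeel-peelStep : ∀ st → unpeel (peelStep st) ≡ unpeel st
unpeel-peelStep st with unpair₁ w ≟ 5 | unpair₂ (unpair₂ w) ≟ 5
  where w = unpair₁ st
... | no ≢5 | _ = cong unpeel (ifEq-≢ _ _ ≢5)
... | yes tag≡5 | no ≢5 = cong unpeel (trans (ifEq-≡ _ _ tag≡5) (ifEq-≢ _ _ ≢5))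
... | yes tag≡5 | yes pad≡5 = begin
  unpeel (peelStep st)          ≡⟨ cong unpeel (trans (ifEq-≡ _ _ tag≡5) (ifEq-≡ _ _ pad≡5)) ⟩
  unpeel (pair w′ (suc j))      ≡⟨ unpeel-pair w′ (suc j) ⟩
  fold w′ padLayer (suc j)      ≡⟨ fold-suc w′ padLayer j ⟩
  fold (padLayer w′) padLayer j ≡⟨ cong (λ v → fold v padLayer j) w≡ ⟩
  unpeel st                     ∎
  where
  open ≡-Reasoning
  w  = unpair₁ st
  j  = unpair₂ st
  w′ = unpair₁ (unpair₂ w)
  w≡ : padLayer w′ ≡ w
  w≡ = begin
    pair 5 (pair w′ 5)                                   ≡⟨ cong₂ (λ a b → pair a (pair w′ b)) (sym tag≡5) (sym pad≡5) ⟩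
    pair (unpair₁ w) (pair w′ (unpair₂ (unpair₂ w)))     ≡⟨ cong (pair (unpair₁ w)) (pair-unpair (unpair₂ w)) ⟩
    pair (unpair₁ w) (unpair₂ w)                         ≡⟨ pair-unpair w ⟩
    w                                                    ∎

unpeel-peel : ∀ y → unpeel (peel y) ≡ y
unpeel-peel y = go y
  where
  go : ∀ k → unpeel (fold (pair y 0) peelStep k) ≡ y
  go zero    = unpeel-pair y 0
  go (suc k) = trans (unpeel-peelStep (fold (pair y 0) peelStep k)) (go k)

-- Dyadic blocks. The state ⟨b , 2ᵇ⟩ doubles its bound whenever the counter reaches it,
-- so for 2ᵗ ≤ x < 2ᵗ⁺¹ the state after x steps is ⟨t + 1 , 2ᵗ⁺¹⟩.
blockStep : ℕ → ℕ → ℕ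
blockStep n st =
  ifEq (suc n) (unpair₂ st) (pair (suc (unpair₁ st)) (unpair₂ st + unpair₂ st)) st

blockState : ℕ → ℕ
blockState zero    = pair 0 1
blockState (suc n) = blockStep n (blockState n)

block : ℕ → ℕ
block x = unpair₁ (blockState x)

InBlock : ℕ → ℕ → Set
InBlock x t = blockState x ≡ pair (suc t) (2 ^ suc t) × 2 ^ t ≤ x × x < 2 ^ suc t

2^-double : ∀ t → 2 ^ suc t ≡ 2 ^ t + 2 ^ t
2^-double t = cong (2 ^ t +_) (+-identityʳ (2 ^ t))

blockStep-pair : ∀ n t → blockStep n (pair t (2 ^ t)) ≡
  ifEq (suc n) (2 ^ t) (pair (suc t) (2 ^ suc t)) (pair t (2 ^ t))
blockStep-pair n t rewrite unpair₁-pair t (2 ^ t) | unpair₂-pair t (2 ^ t) | 2^-double t = refl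

inBlock-suc : ∀ n → Σ ℕ (InBlock (suc n))
inBlock-suc zero    = 0 , trans (blockStep-pair 0 0) (ifEq-≡ _ _ refl) , ≤-refl , s≤s (s≤s z≤n)
inBlock-suc (suc n) with inBlock-suc n
... | t , st≡ , lo , hi with suc (suc n) ≟ 2 ^ suc t
...   | yes at-bound =
  suc t , trans (cong (blockStep (suc n)) st≡)
                (trans (blockStep-pair (suc n) (suc t)) (ifEq-≡ _ _ at-bound))
        , ≤-reflexive (sym at-bound)
        , subst (_< 2 ^ suc (suc t)) (sym at-bound)
            (subst (2 ^ suc t <_) (sym (2^-double (suc t))) (m<m+n (2 ^ suc t) (m^n>0 2 (suc t))))
...   | no below-bound =
  t , trans (cong (blockStep (suc n)) st≡)
            (trans (blockStep-pair (suc n) (suc t)) (ifEq-≢ _ _ below-bound))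
    , m≤n⇒m≤1+n lo , ≤∧≢⇒< hi below-bound

block-of : ∀ t x → 2 ^ t ≤ x → x < 2 ^ suc t → block x ≡ suc t
block-of t zero    lo hi = contradiction lo (<⇒≱ (m^n>0 2 t))
block-of t (suc n) lo hi with inBlock-suc n
... | t′ , st≡ , lo′ , hi′ with <-cmp t t′
...   | tri≈ _ refl _ = trans (cong unpair₁ st≡) (unpair₁-pair (suc t) _)
...   | tri< t<t′ _ _ = contradiction (≤-trans (^-monoʳ-≤ 2 t<t′) lo′) (<⇒≱ hi)
...   | tri> _ _ t′<t = contradiction (≤-trans (^-monoʳ-≤ 2 t′<t) lo) (<⇒≱ hi′)

-- The code attached to block s = ⟨⟨u , v⟩ , _⟩ is encode (cComp f g) for u = encode f,
-- v + 6 = encode g.  The code g is read off the block rather than fixed because the g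
-- we need, πOfFst, mentions the code of π itself.  As v + 6 ≠ 5 = encode cId, the
-- attached code is stuck for peeling.
blockCode : ℕ → ℕ
blockCode s = pair 5 (pair (unpair₁ (unpair₁ s)) (unpair₂ (unpair₁ s) + 6))

diagCode : ℕ → ℕ
diagCode x = blockCode (block x)

diagCode-stuck : ∀ x → Stuck (diagCode x)
diagCode-stuck x = stuck (diagCode x) λ eq → 6≰5 (subst (6 ≤_) (trans (sym inner≡) eq) (m≤n+m 6 v))
  where
  u = unpair₁ (unpair₁ (block x))
  v = unpair₂ (unpair₁ (block x))
  inner≡ : unpair₂ (unpair₂ (diagCode x)) ≡ v + 6
  inner≡ = trans (cong unpair₂ (unpair₂-pair 5 (pair u (v + 6)))) (unpair₂-pair u (v + 6))
  6≰5 : ¬ 6 ≤ 5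
  6≰5 (s≤s (s≤s (s≤s (s≤s (s≤s ())))))

-- The permutation swaps each x whose first component is not 8 with its partner, the
-- code of "cMu (pad x f)" where diagCode x = encode f; everything else is fixed.
partner : ℕ → ℕ
partner x = pair 8 (fold (diagCode x) padLayer x)

unpartnerFrom : ℕ → ℕ → ℕ → ℕ
unpartnerFrom z j y = ifEq (unpair₁ j) 8 y (ifEq (diagCode j) z j y)

unpartner : ℕ → ℕ
unpartner y = unpartnerFrom (unpair₁ (peel (unpair₂ y))) (unpair₂ (peel (unpair₂ y))) y

π : ℕ → ℕ
π x = ifEq (unpair₁ x) 8 (unpartner x) (partner x)

π-untagged : ∀ x → unpair₁ x ≢ 8 → π x ≡ partner x
π-untagged x ≢8 = ifEq-≢ (unpartner x) (partner x) ≢8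

π-tagged : ∀ x → unpair₁ x ≡ 8 → π x ≡ unpartner x
π-tagged x ≡8 = ifEq-≡ (unpartner x) (partner x) ≡8

unpartner-partner : ∀ x → unpair₁ x ≢ 8 → unpartner (partner x) ≡ x
unpartner-partner x ≢8 = begin
  unpartner (partner x)
    ≡⟨ cong (λ st → unpartnerFrom (unpair₁ st) (unpair₂ st) (partner x)) peeled ⟩
  unpartnerFrom (unpair₁ (pair (diagCode x) x)) (unpair₂ (pair (diagCode x) x)) (partner x)
    ≡⟨ cong₂ (λ z j → unpartnerFrom z j (partner x)) (unpair₁-pair (diagCode x) x) (unpair₂-pair (diagCode x) x) ⟩
  ifEq (unpair₁ x) 8 (partner x) (ifEq (diagCode x) (diagCode x) x (partner x))
    ≡⟨ ifEq-≢ (partner x) _ ≢8 ⟩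
  ifEq (diagCode x) (diagCode x) x (partner x)
    ≡⟨ ifEq-≡ x (partner x) refl ⟩
  x ∎
  where
  open ≡-Reasoning
  peeled : peel (unpair₂ (partner x)) ≡ pair (diagCode x) x
  peeled = trans (cong peel (unpair₂-pair 8 (fold (diagCode x) padLayer x)))
                 (peel-padded (diagCode x) (diagCode-stuck x) x)

PartnerOrFixed : ℕ → ℕ → Set
PartnerOrFixed y u = u ≡ y ⊎ (unpair₁ u ≢ 8 × partner u ≡ y)

unpartnerFrom-spec : ∀ z j y → fold z padLayer j ≡ unpair₂ y → unpair₁ y ≡ 8 →
  PartnerOrFixed y (unpartnerFrom z j y)
unpartnerFrom-spec z j y unpeeled ≡8 with unpair₁ j ≟ 8 | diagCode j ≟ z
... | yes j≡8 | _      = inj₁ (ifEq-≡ y _ j≡8)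
... | no  j≢8 | no  z≢ = inj₁ (trans (ifEq-≢ y _ j≢8) (ifEq-≢ j y z≢))
... | no  j≢8 | yes z≡ = inj₂ (subst (λ u → unpair₁ u ≢ 8) (sym result≡j) j≢8 , partner≡y)
  where
  open ≡-Reasoning
  result≡j : unpartnerFrom z j y ≡ j
  result≡j = trans (ifEq-≢ y _ j≢8) (ifEq-≡ j y z≡)
  partner≡y : partner (unpartnerFrom z j y) ≡ y
  partner≡y = begin
    partner (unpartnerFrom z j y)          ≡⟨ cong partner result≡j ⟩
    pair 8 (fold (diagCode j) padLayer j)  ≡⟨ cong (λ w → pair 8 (fold w padLayer j)) z≡ ⟩
    pair 8 (fold z padLayer j)             ≡⟨ cong (pair 8) unpeeled ⟩
    pair 8 (unpair₂ y)                     ≡⟨ cong (λ a → pair a (unpair₂ y)) (sym ≡8) ⟩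
    pair (unpair₁ y) (unpair₂ y)           ≡⟨ pair-unpair y ⟩
    y                                      ∎

unpartner-spec : ∀ y → unpair₁ y ≡ 8 → PartnerOrFixed y (unpartner y)
unpartner-spec y = unpartnerFrom-spec _ _ y (unpeel-peel (unpair₂ y))

π-involutive : ∀ x → π (π x) ≡ x
π-involutive x = byTag (unpair₁ x ≟ 8)
  where
  open ≡-Reasoning
  byTag : Dec (unpair₁ x ≡ 8) → π (π x) ≡ x
  byTag (no ≢8) = begin
    π (π x)               ≡⟨ cong π (π-untagged x ≢8) ⟩
    π (partner x)         ≡⟨ π-tagged (partner x) (unpair₁-pair 8 (fold (diagCode x) padLayer x)) ⟩
    unpartner (partner x) ≡⟨ unpartner-partner x ≢8 ⟩
    x                     ∎
  byTag (yes ≡8) = bySpec (unpartner-spec x ≡8)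
    where
    πx≡ : π x ≡ unpartner x
    πx≡ = π-tagged x ≡8
    bySpec : PartnerOrFixed x (unpartner x) → π (π x) ≡ x
    bySpec (inj₁ fixed) = begin
      π (π x)         ≡⟨ cong π πx≡ ⟩
      π (unpartner x) ≡⟨ cong π fixed ⟩
      π x             ≡⟨ πx≡ ⟩
      unpartner x     ≡⟨ fixed ⟩
      x               ∎
    bySpec (inj₂ (≢8 , partner≡x)) = begin
      π (π x)               ≡⟨ cong π πx≡ ⟩
      π (unpartner x)       ≡⟨ π-untagged (unpartner x) ≢8 ⟩
      partner (unpartner x) ≡⟨ partner≡x ⟩
      x                     ∎

pPeelStep : PR
pPeelStep = pIfEq (pComp pFst pFst) (pConst 5)
              (pIfEq (pComp pSnd (pComp pSnd pFst)) (pConst 5)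
                     (pPair (pComp pFst (pComp pSnd pFst)) (pComp pSucc pSnd)) pId)
              pId

pPeelStep-sem : ∀ st → ⟦ pPeelStep ⟧ st ≡ peelStep st
pPeelStep-sem st =
  trans (pIfEq-sem (pComp pFst pFst) (pConst 5) inner pId st)
        (cong (λ v → ifEq (unpair₁ (unpair₁ st)) 5 v st)
              (pIfEq-sem (pComp pSnd (pComp pSnd pFst)) (pConst 5)
                         (pPair (pComp pFst (pComp pSnd pFst)) (pComp pSucc pSnd)) pId st))
  where
  inner = pIfEq (pComp pSnd (pComp pSnd pFst)) (pConst 5)
                (pPair (pComp pFst (pComp pSnd pFst)) (pComp pSucc pSnd)) pId

pPeel : PR
pPeel = pComp (pFold (pPair pId pZero) pPeelStep) (pPair pId pId)

pPeel-sem : ∀ y → ⟦ pPeel ⟧ y ≡ peel y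
pPeel-sem y = trans (pFold-sem (pPair pId pZero) pPeelStep y y)
                    (fold-cong pPeelStep-sem (pair y 0) y)

pBlockStep : PR
pBlockStep =
  pIfEq (pComp pSucc (pComp pFst pSnd)) (pComp pSnd st)
        (pPair (pComp pSucc (pComp pFst st)) (pComp pAdd (pPair (pComp pSnd st) (pComp pSnd st))))
        st
  where
  st = pComp pSnd pSnd

pBlockStep-sem : ∀ a n st → ⟦ pBlockStep ⟧ (pair a (pair n st)) ≡ blockStep n st
pBlockStep-sem a n st
  rewrite pIfEq-sem (pComp pSucc (pComp pFst pSnd)) (pComp pSnd (pComp pSnd pSnd))
            (pPair (pComp pSucc (pComp pFst (pComp pSnd pSnd)))
                   (pComp pAdd (pPair (pComp pSnd (pComp pSnd pSnd)) (pComp pSnd (pComp pSnd pSnd)))))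
            (pComp pSnd pSnd) (pair a (pair n st))
        | unpair₂-pair a (pair n st) | unpair₁-pair n st | unpair₂-pair n st
        | pAdd-sem (unpair₂ st) (unpair₂ st) = refl

pBlockState : PR
pBlockState = pComp (pRec (pPair pZero (pConst 1)) pBlockStep) (pPair pZero pId)

pBlockState-sem : ∀ x → ⟦ pBlockState ⟧ x ≡ blockState x
pBlockState-sem x = trans (pRec-pair (pPair pZero (pConst 1)) pBlockStep 0 x) (go x)
  where
  go : ∀ x → primRec ⟦ pPair pZero (pConst 1) ⟧ ⟦ pBlockStep ⟧ 0 x ≡ blockState x
  go zero    = refl
  go (suc x) = trans (pBlockStep-sem 0 x _) (cong (blockStep x) (go x))

pDiagCode : PR
pDiagCode = pComp blockCodeᴾ (pComp pFst pBlockState)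
  where
  blockCodeᴾ = pPair (pConst 5) (pPair (pComp pFst pFst) (pComp pAdd (pPair (pComp pSnd pFst) (pConst 6))))

pDiagCode-sem : ∀ x → ⟦ pDiagCode ⟧ x ≡ diagCode x
pDiagCode-sem x = begin
  ⟦ pDiagCode ⟧ x
    ≡⟨ cong (λ v → pair 5 (pair (unpair₁ (unpair₁ s)) v)) (pAdd-sem (unpair₂ (unpair₁ s)) 6) ⟩
  blockCode s
    ≡⟨ cong (λ st → blockCode (unpair₁ st)) (pBlockState-sem x) ⟩
  diagCode x ∎
  where
  open ≡-Reasoning
  s = unpair₁ (⟦ pBlockState ⟧ x)

pPartner : PR
pPartner = pPair (pConst 8) (pComp (pFold pId padLayerᴾ) (pPair pDiagCode pId))
  where
  padLayerᴾ = pPair (pConst 5) (pPair pId (pConst 5))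

pPartner-sem : ∀ x → ⟦ pPartner ⟧ x ≡ partner x
pPartner-sem x = cong (pair 8) (begin
  ⟦ pFold pId (pPair (pConst 5) (pPair pId (pConst 5))) ⟧ (pair (⟦ pDiagCode ⟧ x) x)
    ≡⟨ pFold-sem pId (pPair (pConst 5) (pPair pId (pConst 5))) (⟦ pDiagCode ⟧ x) x ⟩
  fold (⟦ pDiagCode ⟧ x) padLayer x
    ≡⟨ cong (λ z → fold z padLayer x) (pDiagCode-sem x) ⟩
  fold (diagCode x) padLayer x ∎)
  where open ≡-Reasoning

pUnpartner : PR
pUnpartner = pIfEq (pComp pFst j) (pConst 8) pId (pIfEq (pComp pDiagCode j) z j pId)
  where
  peeled = pComp pPeel pSnd
  z = pComp pFst peeled
  j = pComp pSnd peeled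

pUnpartner-sem : ∀ y → ⟦ pUnpartner ⟧ y ≡ unpartner y
pUnpartner-sem y = begin
  ⟦ pUnpartner ⟧ y
    ≡⟨ pIfEq-sem (pComp pFst j) (pConst 8) pId (pIfEq (pComp pDiagCode j) z j pId) y ⟩
  ifEq (unpair₁ (⟦ j ⟧ y)) 8 y (⟦ pIfEq (pComp pDiagCode j) z j pId ⟧ y)
    ≡⟨ cong (ifEq (unpair₁ (⟦ j ⟧ y)) 8 y) (pIfEq-sem (pComp pDiagCode j) z j pId y) ⟩
  ifEq (unpair₁ (⟦ j ⟧ y)) 8 y (ifEq (⟦ pDiagCode ⟧ (⟦ j ⟧ y)) (⟦ z ⟧ y) (⟦ j ⟧ y) y)
    ≡⟨ cong (λ d → ifEq (unpair₁ (⟦ j ⟧ y)) 8 y (ifEq d (⟦ z ⟧ y) (⟦ j ⟧ y) y)) (pDiagCode-sem (⟦ j ⟧ y)) ⟩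
  unpartnerFrom (⟦ z ⟧ y) (⟦ j ⟧ y) y
    ≡⟨ cong (λ st → unpartnerFrom (unpair₁ st) (unpair₂ st) y) (pPeel-sem (unpair₂ y)) ⟩
  unpartner y ∎
  where
  open ≡-Reasoning
  peeled = pComp pPeel pSnd
  z = pComp pFst peeled
  j = pComp pSnd peeled

pπ : PR
pπ = pIfEq pFst (pConst 8) pUnpartner pPartner

pπ-sem : ∀ x → ⟦ pπ ⟧ x ≡ π x
pπ-sem x = trans (pIfEq-sem pFst (pConst 8) pUnpartner pPartner x)
                 (cong₂ (ifEq (unpair₁ x) 8) (pUnpartner-sem x) (pPartner-sem x))

map-unique : ∀ {P : ℕ → Set} (f : ℕ → ℕ) → (∀ {a b} → P a → P b → f a ≡ f b → a ≡ b) →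
             ∀ {l} → All P l → Unique l → Unique (map f l)
map-unique f inj [] [] = []
map-unique {P} f inj {x ∷ xs} (px ∷ pxs) (x∉xs ∷ unique) = fresh pxs x∉xs ∷ map-unique f inj pxs unique
  where
  fresh : ∀ {ys} → All P ys → All (x ≢_) ys → All (f x ≢_) (map f ys)
  fresh []         []           = []
  fresh (py ∷ pys) (x≢y ∷ x≢ys) = (λ eq → x≢y (inj px py eq)) ∷ fresh pys x≢ys

rename : ℕ → ℕ → ℕ → ℕ
rename m x y with y ≟ m
... | yes _ = x
... | no  _ = y

rename-< : ∀ m x y → x < suc m → x ≢ y → y < suc m → rename m x y < m
rename-< m x y x< x≢y y< with y ≟ m
... | yes refl = ≤∧≢⇒< (≤-pred x<) x≢y
... | no  y≢m  = ≤∧≢⇒< (≤-pred y<) y≢m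

rename-injective : ∀ m x a b → x ≢ a → x ≢ b → rename m x a ≡ rename m x b → a ≡ b
rename-injective m x a b x≢a x≢b eq with a ≟ m | b ≟ m
... | yes a≡m | yes b≡m = trans a≡m (sym b≡m)
... | yes _   | no  _   = contradiction eq x≢b
... | no  _   | yes _   = contradiction (sym eq) x≢a
... | no  _   | no  _   = eq

unique-length-≤ : ∀ m l → Unique l → All (_< m) l → length l ≤ m
unique-length-≤ m       []       _                _               = z≤n
unique-length-≤ (suc m) (x ∷ xs) (x∉xs ∷ unique) (x< ∷ xs<) = s≤s (begin
  length xs                 ≡⟨ length-map (rename m x) xs ⟨
  length (map (rename m x) xs) ≤⟨ unique-length-≤ m (map (rename m x) xs) renamed-unique renamed-< ⟩
  m                         ∎)
  where
  open ≤-Reasoning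
  rest = All.zip (x∉xs , xs<)
  renamed-unique : Unique (map (rename m x) xs)
  renamed-unique = map-unique (rename m x) (λ pa pb → rename-injective m x _ _ (proj₁ pa) (proj₁ pb)) rest unique
  renamed-< : All (_< m) (map (rename m x) xs)
  renamed-< = gmap⁺ (λ {y} (x≢y , y<) → rename-< m x y x< x≢y y<) rest

SmallOrTagged : ℕ → ℕ → Set
SmallOrTagged q i = i < 2 * q ⊎ unpair₁ i ≡ 8

tagged : ∀ q {i} → ¬ i < 2 * q → SmallOrTagged q i → pair 8 (unpair₂ i) ≡ i
tagged q ¬small (inj₁ small) = contradiction small ¬small
tagged q {i} ¬small (inj₂ ≡8) = trans (cong (λ a → pair a (unpair₂ i)) (sym ≡8)) (pair-unpair i)

4b≤pair8 : ∀ b → 4 * b ≤ pair 8 b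
4b≤pair8 b = ≤-trans four-terms (m≤m+n (tri (8 + b)) 8)
  where
  four-terms : 4 * b ≤ tri (8 + b)
  four-terms = +-mono-≤ (m≤n+m b 8) (+-mono-≤ (m≤n+m b 7) (+-mono-≤ (m≤n+m b 6)
                 (+-mono-≤ (m≤n+m b 5) (z≤n {tri (4 + b)}))))

compress : ℕ → ℕ → ℕ
compress q i with i <? 2 * q
... | yes _ = i
... | no  _ = 2 * q + unpair₂ i

compress-injective : ∀ q {a b} → SmallOrTagged q a → SmallOrTagged q b →
                     compress q a ≡ compress q b → a ≡ b
compress-injective q {a} {b} sa sb eq with a <? 2 * q | b <? 2 * q
... | yes _ | yes _ = eq
... | yes a< | no _ = contradiction (subst (2 * q ≤_) (sym eq) (m≤m+n (2 * q) (unpair₂ b))) (<⇒≱ a<)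
... | no _ | yes b< = contradiction (subst (2 * q ≤_) eq (m≤m+n (2 * q) (unpair₂ a))) (<⇒≱ b<)
... | no a≮ | no b≮ = begin
  a                    ≡⟨ tagged q a≮ sa ⟨
  pair 8 (unpair₂ a)   ≡⟨ cong (pair 8) (+-cancelˡ-≡ (2 * q) _ _ eq) ⟩
  pair 8 (unpair₂ b)   ≡⟨ tagged q b≮ sb ⟩
  b                    ∎
  where open ≡-Reasoning

compress-< : ∀ q i → i < 2 * (2 * q) → SmallOrTagged q i → compress q i < 2 * q + q
compress-< q i i< si with i <? 2 * q
... | yes small = ≤-trans small (m≤m+n (2 * q) q)
... | no ¬small = +-monoʳ-< (2 * q) (*-cancelˡ-< 4 (unpair₂ i) q (begin-strict
  4 * unpair₂ i        ≤⟨ 4b≤pair8 (unpair₂ i) ⟩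
  pair 8 (unpair₂ i)   ≡⟨ tagged q ¬small si ⟩
  i                    <⟨ i< ⟩
  2 * (2 * q)          ≡⟨ *-assoc 2 2 q ⟨
  4 * q                ∎))
  where open ≤-Reasoning

small-or-tagged-count : ∀ q l → Unique l → All (λ i → i < 2 * (2 * q) × SmallOrTagged q i) l →
                        length l ≤ 3 * q
small-or-tagged-count q l unique bounded = begin
  length l                       ≡⟨ length-map (compress q) l ⟨
  length (map (compress q) l)    ≤⟨ unique-length-≤ (2 * q + q) (map (compress q) l) compressed-unique compressed-< ⟩
  2 * q + q                      ≡⟨ 2q+q≡3q q ⟩
  3 * q                          ∎
  where
  open ≤-Reasoning
  2q+q≡3q : ∀ q → 2 * q + q ≡ 3 * q
  2q+q≡3q = solve-∀
  compressed-unique : Unique (map (compress q) l)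
  compressed-unique = map-unique (compress q) (compress-injective q) (All.map proj₂ bounded) unique
  compressed-< : All (_< 2 * q + q) (map (compress q) l)
  compressed-< = gmap⁺ (λ {i} (i< , si) → compress-< q i i< si) bounded

-- Opaque, so that the (huge) Gödel number of π's code is never normalised.
opaque
  πCode : Code
  πCode = compile pπ

  πCode-computes : ∀ x → Eval πCode x (π x)
  πCode-computes x = subst (Eval πCode x) (pπ-sem x) (compile-sound pπ x)

-- An involution is a bijection.
π-bijective : Bijective _≡_ _≡_ π
π-bijective = injective , λ y → π y , λ {x} x≡πy → trans (cong π x≡πy) (π-involutive y)
  where
  injective : ∀ {x y} → π x ≡ π y → x ≡ y
  injective {x} {y} eq = begin
    x        ≡⟨ π-involutive x ⟨
    π (π x)  ≡⟨ cong π eq ⟩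
    π (π y)  ≡⟨ π-involutive y ⟩
    y        ∎
    where open ≡-Reasoning

π-computablePermutation : ComputablePermutation π
π-computablePermutation = (πCode , πCode-computes) , π-bijective

image-involution⁺ : ∀ (A : ℕ → Set) x → A (π x) → image π A x
image-involution⁺ A x a = π x , π-involutive x , a

image-involution⁻ : ∀ (A : ℕ → Set) x → image π A x → A (π x)
image-involution⁻ A x (n , πn≡x , a) = subst A (trans (sym (π-involutive n)) (cong π πn≡x)) a

halting-self : ∀ d → HaltingSet (encode d) → Halts d (encode d)
halting-self d (d′ , encode≡ , halts) = subst (λ c → Halts c (encode d)) (encode-injective d′ d encode≡) halts

πOfFst : Code
πOfFst = cComp πCode cFst

πOfFst-computes : ∀ e m → Eval πOfFst (pair e m) (π e)
πOfFst-computes e m =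
  eComp eFst (subst (λ a → Eval πCode (unpair₁ (pair e m)) (π a)) (unpair₁-pair e m) (πCode-computes _))

-- The refuter of c at x: on input e it halts iff c(π e) = 0.  It is padded with x
-- layers so that its Gödel number is the partner of x when diagCode x codes cComp c πOfFst.
refuter : Code → ℕ → Code
refuter c x = cMu (pad x (cComp c πOfFst))

refuter-halts : ∀ c x e → Eval c (π e) 0 → Halts (refuter c x) e
refuter-halts c x e c0 = 0 , eMu (pad-Eval⁺ x _ (eComp (πOfFst-computes e 0) c0)) (λ _ ())

refuter-halts⁻ : ∀ c x e → Halts (refuter c x) e → Eval c (π e) 0
refuter-halts⁻ c x e (m , eMu found _) with pad-Eval⁻ x _ found
... | eComp πe c0 = subst (λ a → Eval c a 0) (Eval-deterministic πe (πOfFst-computes e m)) c0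

partner-refuter : ∀ c x → diagCode x ≡ encode (cComp c πOfFst) → partner x ≡ encode (refuter c x)
partner-refuter c x code≡ = cong (pair 8) (begin
  fold (diagCode x) padLayer x               ≡⟨ cong (λ z → fold z padLayer x) code≡ ⟩
  fold (encode (cComp c πOfFst)) padLayer x  ≡⟨ encode-pad x (cComp c πOfFst) ⟨
  encode (pad x (cComp c πOfFst))            ∎)
  where open ≡-Reasoning

refutation : ∀ c x → unpair₁ x ≢ 8 → diagCode x ≡ encode (cComp c πOfFst) →
             Eval c x 0 ⇔ image π HaltingSet x
refutation c x ≢8 code≡ = mk⇔ zero⇒in in⇒zero
  where
  r = refuter c x
  πx≡r : π x ≡ encode r
  πx≡r = trans (π-untagged x ≢8) (partner-refuter c x code≡)
  πr≡x : π (encode r) ≡ x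
  πr≡x = trans (cong π (sym πx≡r)) (π-involutive x)
  zero⇒in : Eval c x 0 → image π HaltingSet x
  zero⇒in c0 = image-involution⁺ HaltingSet x (subst HaltingSet (sym πx≡r)
    (r , refl , refuter-halts c x (encode r) (subst (λ a → Eval c a 0) (sym πr≡x) c0)))
  in⇒zero : image π HaltingSet x → Eval c x 0
  in⇒zero x∈ = subst (λ a → Eval c a 0) πr≡x (refuter-halts⁻ c x (encode r)
    (halting-self r (subst HaltingSet πx≡r (image-involution⁻ HaltingSet x x∈))))

description-diverges : ∀ c → PartialDescription c (image π HaltingSet) →
  ∀ x → unpair₁ x ≢ 8 → diagCode x ≡ encode (cComp c πOfFst) → ¬ Halts c x
description-diverges c (boolean , says-in , says-out) x ≢8 code≡ (v , cx≡v) =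
  byValue cx≡v (boolean x v cx≡v)
  where
  open Equivalence (refutation c x ≢8 code≡)
  byValue : ∀ {w} → Eval c x w → w ≡ 0 ⊎ w ≡ 1 → ⊥
  byValue c0 (inj₁ refl) = says-out x c0 (to c0)
  byValue c1 (inj₂ refl) = contradiction (Eval-deterministic c1 (from (says-in x c1))) λ ()

n<2^n : ∀ n → n < 2 ^ n
n<2^n zero    = s≤s z≤n
n<2^n (suc n) = subst (_≤ 2 ^ suc n) (+-comm (suc n) 1)
  (+-mono-≤ (n<2^n n) (≤-trans (m^n>0 2 n) (m≤m+n (2 ^ n) 0)))

OwnedBlock : Code → ℕ → ℕ → Set
OwnedBlock c N r = N ≤ 2 * (2 * 2 ^ r) ×
  (∀ x → 2 * 2 ^ r ≤ x → x < 2 * (2 * 2 ^ r) → diagCode x ≡ encode (cComp c πOfFst))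

-- Every c owns arbitrarily late blocks: the block with index
-- ⟨⟨encode c , encode πOfFst ∸ 6⟩ , 2 + N⟩ attaches the code of cComp c πOfFst.
late-block : ∀ c N → Σ ℕ (OwnedBlock c N)
late-block c N = go s (≤-pair₂ (pair u v) (2 + N)) refl
  where
  u = encode c
  v = encode πOfFst ∸ 6
  s = pair (pair u v) (2 + N)
  6≤πOfFst : 6 ≤ encode πOfFst
  6≤πOfFst = s≤s (m≤n+m 5 ((4 + pair (encode πCode) 9) + tri (4 + pair (encode πCode) 9)))
  blockCode-s : blockCode s ≡ encode (cComp c πOfFst)
  blockCode-s rewrite unpair₁-pair (pair u v) (2 + N) | unpair₁-pair u v | unpair₂-pair u v =
    cong (λ w → pair 5 (pair u w)) (m∸n+n≡m 6≤πOfFst)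
  go : ∀ t → 2 + N ≤ t → t ≡ s → Σ ℕ (OwnedBlock c N)
  go (suc (suc r)) (s≤s (s≤s N≤r)) t≡s =
    r , ≤-trans N≤r (≤-trans (<⇒≤ (n<2^n r)) (≤-trans (m≤m+n (2 ^ r) _) (m≤m+n _ _)))
      , λ x lo hi → trans (cong blockCode (trans (block-of (suc r) x lo hi) t≡s)) blockCode-s

too-few : ∀ q m → 0 < q → 7 * (2 * (2 * q)) ≤ 8 * m → m ≤ 3 * q → ⊥
too-few q m q>0 dense m≤ = <⇒≱ (begin-strict
  8 * (3 * q)                <⟨ m<m+n (8 * (3 * q)) (*-monoʳ-< 4 q>0) ⟩
  8 * (3 * q) + 4 * q        ≡⟨ arith q ⟨
  7 * (2 * (2 * q))          ∎) (≤-trans dense (*-monoʳ-≤ 8 m≤))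
  where
  open ≤-Reasoning
  arith : ∀ q → 7 * (2 * (2 * q)) ≡ 8 * (3 * q) + 4 * q
  arith = solve-∀

-- π(∅') is not generic-case computable: in the late block [2q , 4q) owned by c, c
-- halts only on tagged numbers, so c's domain has density at most 3/4 below 4q.
not-generic : ¬ GenericCaseComputable (image π HaltingSet)
not-generic (c , description , dense) with dense 7
... | N , large with late-block c N
... | r , N≤ , owned with large (2 * (2 * 2 ^ r)) N≤
... | l , unique , members , ratio =
  too-few q (length l) (m^n>0 2 r) ratio (small-or-tagged-count q l unique (All.map classify members))
  where
  q = 2 ^ r
  classify : ∀ {i} → i < 2 * (2 * q) × Halts c i → i < 2 * (2 * q) × SmallOrTagged q i
  classify {i} (i< , halts) with i <? 2 * q | unpair₁ i ≟ 8
  ... | yes small | _      = i< , inj₁ small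
  ... | no  _     | yes ≡8 = i< , inj₂ ≡8
  ... | no  large | no  ≢8 =
    contradiction halts (description-diverges c description i ≢8 (owned i (≮⇒≥ large) i<))

mainTheorem4 : ∃[ π ] (ComputablePermutation π × ¬ GenericCaseComputable (image π HaltingSet))
mainTheorem4 = π , π-computablePermutation , not-generic
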